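{- Let $n,k$ be positive integers with $k \ge 3$. The set $W := Y(1,1) \cup \bigcup_{i=2}^{k-1} Y(2,i)$ has exactly $k^{n-1}+1$ elements.
   Context: Vertices of the Hamming graph $H(n,k)$ are vectors $v=(v(1),\dots,v(n))\in \mathbb{Z}_k^n$ with $\mathbb{Z}_k=\{0,1,\dots,k-1\}$; all arithmetic is modulo $k$. For $v \neq (0,\dots,0)$, $\ell(v)$ is the largest index $1\le i\le n$ with $v(i)\neq 0$. For $s,t\in\mathbb{Z}_k$ with $t\neq 0$, $Y(s,t)$ is the set of nonzero vertices $v$ with $\sum_{i=1}^n v(i)\equiv s \pmod k$ and $v(\ell(v)) = t$. -}

module Defs where

open import Data.Nat using (ℕ; zero; suc; _+_; _≤_; _%_; NonZero)
open import Data.Fin using (Fin; toℕ; fromℕ<)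
open import Data.Nat.Properties using (≤-trans; n≤1+n)
open import Data.Vec using (Vec; []; _∷_; allFin)
open import Data.List using (List; []; _∷_; concatMap; map; filter; length)
open import Data.Maybe using (Maybe; just; nothing)
open import Data.Product using (Σ; ∃; _×_; _,_)
open import Data.Sum using (_⊎_)
open import Relation.Binary.PropositionalEquality using (_≡_; _≢_)
open import Relation.Nullary using (¬_)

-- Vertices of H(n,k): vectors in Z_k^n, Z_k represented by Fin k.
Vertex : ℕ → ℕ → Set
Vertex n k = Vec (Fin k) n

-- Sum of coordinates as a natural number (reduce mod k to get the Z_k sum).
coordSum : ∀ {n k} → Vertex n k → ℕ
coordSum []       = 0
coordSum (x ∷ xs) = toℕ x + coordSum xs

-- v(ℓ(v)): the entry at the largest index with a nonzero entry;
-- nothing iff v is the zero vector.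
lastNonzero : ∀ {n k} → Vertex n k → Maybe (Fin k)
lastNonzero []       = nothing
lastNonzero (x ∷ xs) with lastNonzero xs
... | just t  = just t
... | nothing with toℕ x
...   | zero  = nothing
...   | suc _ = just x

-- v ∈ Y(s,t)  (t ≠ 0): v nonzero, sum v ≡ s (mod k), v(ℓ(v)) = t.
-- Nonzeroness of v is implied by lastNonzero v ≡ just t.
InY : ∀ {n k} .{{_ : NonZero k}} → (s t : Fin k) → Vertex n k → Set
InY {k = k} s t v = (coordSum v % k ≡ toℕ s) × (lastNonzero v ≡ just t)

InW : ∀ {n k} .{{_ : NonZero k}} → (one two : Fin k) → Vertex n k → Set
InW {k = k} one two v =
  InY one one v ⊎ (Σ (Fin k) λ i → (2 ≤ toℕ i) × InY two i v)

oneF : ∀ {k} → 3 ≤ k → Fin k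
oneF {k} p = fromℕ< {1} {k} (≤-trans (n≤1+n 2) p)

twoF : ∀ {k} → 3 ≤ k → Fin k
twoF {k} p = fromℕ< {2} {k} p

-- Fix the last n − 1 coordinates xs of a vertex v. If xs ≠ 0, then ℓ(v) and v(ℓ(v)) are
-- already determined by xs, so v ∈ W pins the coordinate sum to one residue (1 if the last
-- nonzero entry of xs is 1, and 2 otherwise), which exactly one first coordinate attains.
-- If xs = 0, then both (1,0,…,0) ∈ Y(1,1) and (2,0,…,0) ∈ Y(2,2) lie in W. Hence W is
-- enumerated by one vertex per tail plus (2,0,…,0), and |W| = k^(n−1) + 1.
module Submission where

open import Defs
open import Data.Nat using (ℕ; zero; suc; _+_; _*_; _∸_; _^_; _≤_; NonZero; _%_; _/_; z≤n; s≤s)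
open import Data.Nat.Properties using (+-assoc; +-comm; +-identityʳ; m+[n∸m]≡n)
open import Data.Nat.DivMod using (_mod_; m≡m%n+[m/n]*n; m%n<n; m%n≤n; m%n%n≡m%n; %-distribˡ-+; [m+kn]%n≡m%n; m<n⇒m%n≡m)
open import Data.Fin using (Fin; suc; toℕ)
open import Data.Fin.Patterns using (0F; 1F; 2F)
open import Data.Fin.Properties using (toℕ-injective; toℕ-fromℕ<; toℕ<n)
open import Data.Vec using (Vec; []; _∷_; replicate)
open import Data.Vec.Properties using (∷-injective; ∷-injectiveʳ)
open import Data.List using (List; []; _∷_; length; map; _++_; allFin; cartesianProductWith)
open import Data.List.Properties using (length-map; length-++; length-tabulate)
open import Data.List.Relation.Unary.Unique.Propositional using (Unique)
import Data.List.Relation.Unary.Unique.Propositional.Properties as Unique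
import Data.List.Relation.Unary.AllPairs as AllPairs
import Data.List.Relation.Unary.All as All
import Data.List.Relation.Unary.All.Properties as All
open import Data.List.Relation.Unary.Any using (here; there)
open import Data.List.Membership.Propositional using (_∈_)
open import Data.List.Membership.Propositional.Properties using (∈-map⁺; ∈-map⁻; ∈-cartesianProductWith⁺; ∈-allFin)
open import Data.Maybe using (Maybe; just; nothing)
open import Data.Product using (Σ; _×_; _,_)
open import Data.Sum using (_⊎_; inj₁; inj₂)
open import Data.Empty using (⊥-elim)
open import Function.Base using (_∘_)
open import Function.Bundles using (_⇔_; mk⇔; Equivalence)
open import Relation.Binary.PropositionalEquality using (_≡_; _≢_; refl; sym; trans; cong; cong₂; module ≡-Reasoning)

open ≡-Reasoning

length-cartesianProductWith : ∀ {a b c} {A : Set a} {B : Set b} {C : Set c} (f : A → B → C) xs ys →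
  length (cartesianProductWith f xs ys) ≡ length xs * length ys
length-cartesianProductWith f []       ys = refl
length-cartesianProductWith f (x ∷ xs) ys = begin
  length (map (f x) ys ++ cartesianProductWith f xs ys)
    ≡⟨ length-++ (map (f x) ys) ⟩
  length (map (f x) ys) + length (cartesianProductWith f xs ys)
    ≡⟨ cong₂ _+_ (length-map (f x) ys) (length-cartesianProductWith f xs ys) ⟩
  length ys + length xs * length ys ∎

module _ {a} {A : Set a} where

  vectors : List A → (n : ℕ) → List (Vec A n)
  vectors xs zero    = [] ∷ []
  vectors xs (suc n) = cartesianProductWith _∷_ xs (vectors xs n)

  length-vectors : ∀ xs n → length (vectors xs n) ≡ length xs ^ n
  length-vectors xs zero    = refl
  length-vectors xs (suc n) =
    trans (length-cartesianProductWith _∷_ xs (vectors xs n)) (cong (length xs *_) (length-vectors xs n))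

  ∈-vectors : ∀ {xs} → (∀ x → x ∈ xs) → ∀ {n} (v : Vec A n) → v ∈ vectors xs n
  ∈-vectors ∈xs []      = here refl
  ∈-vectors ∈xs (x ∷ v) = ∈-cartesianProductWith⁺ _∷_ (∈xs x) (∈-vectors ∈xs v)

  vectors⁺ : ∀ {xs} → Unique xs → ∀ n → Unique (vectors xs n)
  vectors⁺ u zero    = All.[] AllPairs.∷ AllPairs.[]
  vectors⁺ u (suc n) = Unique.cartesianProductWith⁺ _∷_ ∷-injective u (vectors⁺ u n)

[m%n+o]%n≡[m+o]%n : ∀ m o n .{{_ : NonZero n}} → (m % n + o) % n ≡ (m + o) % n
[m%n+o]%n≡[m+o]%n m o n = begin
  (m % n + o) % n         ≡⟨ %-distribˡ-+ (m % n) o n ⟩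
  (m % n % n + o % n) % n ≡⟨ cong (λ r → (r + o % n) % n) (m%n%n≡m%n m n) ⟩
  (m % n + o % n) % n     ≡⟨ %-distribˡ-+ m o n ⟨
  (m + o) % n             ∎

[m+[o+[n∸o%n]]]%n≡m%n : ∀ m o n .{{_ : NonZero n}} → (m + (o + (n ∸ o % n))) % n ≡ m % n
[m+[o+[n∸o%n]]]%n≡m%n m o n = trans (cong (λ r → (m + r) % n) o+[n∸o%n]≡[1+o/n]*n) ([m+kn]%n≡m%n m (suc (o / n)) n)
  where
  o+[n∸o%n]≡[1+o/n]*n : o + (n ∸ o % n) ≡ suc (o / n) * n
  o+[n∸o%n]≡[1+o/n]*n = begin
    o + (n ∸ o % n)                   ≡⟨ cong (_+ (n ∸ o % n)) (m≡m%n+[m/n]*n o n) ⟩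
    o % n + o / n * n + (n ∸ o % n)   ≡⟨ +-assoc (o % n) (o / n * n) _ ⟩
    o % n + (o / n * n + (n ∸ o % n)) ≡⟨ cong (o % n +_) (+-comm (o / n * n) _) ⟩
    o % n + ((n ∸ o % n) + o / n * n) ≡⟨ +-assoc (o % n) _ (o / n * n) ⟨
    o % n + (n ∸ o % n) + o / n * n   ≡⟨ cong (_+ o / n * n) (m+[n∸m]≡n (m%n≤n o n)) ⟩
    n + o / n * n                     ∎

module _ {n : ℕ} .{{_ : NonZero n}} where

  -- t ⊖ s is the residue t − s in ℤₙ.
  _⊖_ : Fin n → ℕ → Fin n
  t ⊖ s = (toℕ t + (n ∸ s % n)) mod n

  ≡⊖⇔+≡ : ∀ {x t : Fin n} {s} → x ≡ t ⊖ s ⇔ (toℕ x + s) % n ≡ toℕ t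
  ≡⊖⇔+≡ {x} {t} {s} = mk⇔ to from
    where
    c = n ∸ s % n

    to : x ≡ t ⊖ s → (toℕ x + s) % n ≡ toℕ t
    to refl = begin
      (toℕ (t ⊖ s) + s) % n      ≡⟨ cong (λ r → (r + s) % n) (toℕ-fromℕ< (m%n<n (toℕ t + c) n)) ⟩
      ((toℕ t + c) % n + s) % n  ≡⟨ [m%n+o]%n≡[m+o]%n (toℕ t + c) s n ⟩
      (toℕ t + c + s) % n        ≡⟨ cong (_% n) (+-assoc (toℕ t) c s) ⟩
      (toℕ t + (c + s)) % n      ≡⟨ cong (λ r → (toℕ t + r) % n) (+-comm c s) ⟩
      (toℕ t + (s + c)) % n      ≡⟨ [m+[o+[n∸o%n]]]%n≡m%n (toℕ t) s n ⟩
      toℕ t % n                  ≡⟨ m<n⇒m%n≡m (toℕ<n t) ⟩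
      toℕ t                      ∎

    from : (toℕ x + s) % n ≡ toℕ t → x ≡ t ⊖ s
    from x+s≡t = toℕ-injective (begin
      toℕ x                      ≡⟨ m<n⇒m%n≡m (toℕ<n x) ⟨
      toℕ x % n                  ≡⟨ [m+[o+[n∸o%n]]]%n≡m%n (toℕ x) s n ⟨
      (toℕ x + (s + c)) % n      ≡⟨ cong (_% n) (+-assoc (toℕ x) s c) ⟨
      (toℕ x + s + c) % n        ≡⟨ [m%n+o]%n≡[m+o]%n (toℕ x + s) c n ⟨
      ((toℕ x + s) % n + c) % n  ≡⟨ cong (λ r → (r + c) % n) x+s≡t ⟩
      (toℕ t + c) % n            ≡⟨ toℕ-fromℕ< (m%n<n (toℕ t + c) n) ⟨
      toℕ (t ⊖ s)                ∎)

module _ {k : ℕ} where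

  zeros : ∀ n → Vec (Fin (suc k)) n
  zeros n = replicate n 0F

  coordSum-zeros : ∀ n → coordSum (zeros n) ≡ 0
  coordSum-zeros zero    = refl
  coordSum-zeros (suc n) = coordSum-zeros n

  lastNonzero-zeros : ∀ n → lastNonzero (zeros n) ≡ nothing
  lastNonzero-zeros zero = refl
  lastNonzero-zeros (suc n) rewrite lastNonzero-zeros n = refl

  lastNonzero≡nothing⇒zeros : ∀ {n} (v : Vec (Fin (suc k)) n) → lastNonzero v ≡ nothing → v ≡ zeros n
  lastNonzero≡nothing⇒zeros []       _ = refl
  lastNonzero≡nothing⇒zeros (x ∷ xs) e with lastNonzero xs in exs
  lastNonzero≡nothing⇒zeros (0F    ∷ xs) e | nothing = cong (0F ∷_) (lastNonzero≡nothing⇒zeros xs exs)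
  lastNonzero≡nothing⇒zeros (suc _ ∷ xs) () | nothing

  lastNonzero≢just0 : ∀ {n} (v : Vec (Fin (suc k)) n) → lastNonzero v ≢ just 0F
  lastNonzero≢just0 (x ∷ xs) e with lastNonzero xs in exs
  ... | just _ = lastNonzero≢just0 xs (trans exs e)
  lastNonzero≢just0 (0F    ∷ xs) () | nothing
  lastNonzero≢just0 (suc _ ∷ xs) () | nothing

  lastNonzero-∷⁻ : ∀ {n} x (xs : Vec (Fin (suc k)) n) {t} → lastNonzero (x ∷ xs) ≡ just t →
                   lastNonzero xs ≡ just t ⊎ (xs ≡ zeros n × x ≡ t)
  lastNonzero-∷⁻ x xs e with lastNonzero xs in exs
  lastNonzero-∷⁻ x       xs refl | just _  = inj₁ refl
  lastNonzero-∷⁻ (suc _) xs refl | nothing = inj₂ (lastNonzero≡nothing⇒zeros xs exs , refl)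

  ∷zeros-sum⇒≡ : ∀ {n} (x t : Fin (suc k)) → coordSum (x ∷ zeros n) % suc k ≡ toℕ t → x ≡ t
  ∷zeros-sum⇒≡ {n} x t sum≡t = toℕ-injective (begin
    toℕ x                             ≡⟨ m<n⇒m%n≡m (toℕ<n x) ⟨
    toℕ x % suc k                     ≡⟨ cong (_% suc k) (+-identityʳ (toℕ x)) ⟨
    (toℕ x + 0) % suc k               ≡⟨ cong (λ s → (toℕ x + s) % suc k) (coordSum-zeros n) ⟨
    coordSum (x ∷ zeros n) % suc k    ≡⟨ sum≡t ⟩
    toℕ t                             ∎)

module _ {m : ℕ} where

  private
    K : ℕ
    K = 3 + m

  -- The residue that the coordinate sum of v = x ∷ xs must have for v ∈ W; the value at
  -- just 0F is never used, since lastNonzero never returns 0F.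
  residue : Maybe (Fin K) → Fin K
  residue (just (suc (suc _))) = 2F
  residue _                    = 1F

  firstEntry : ∀ {n} → Vec (Fin K) n → Fin K
  firstEntry xs = residue (lastNonzero xs) ⊖ coordSum xs

  W : ∀ n → List (Vec (Fin K) (suc n))
  W n = (2F ∷ zeros n) ∷ map (λ xs → firstEntry xs ∷ xs) (vectors (allFin K) n)

  firstEntry-∈W : ∀ {n} (xs : Vec (Fin K) n) → (firstEntry xs ∷ xs) ∈ W n
  firstEntry-∈W xs = there (∈-map⁺ _ (∈-vectors ∈-allFin xs))

  residue⇒∈W : ∀ {n} x (xs : Vec (Fin K) n) {t} → residue (lastNonzero xs) ≡ t →
               coordSum (x ∷ xs) % K ≡ toℕ t → (x ∷ xs) ∈ W n
  residue⇒∈W x xs refl sum≡r with Equivalence.from (≡⊖⇔+≡ {x = x}) sum≡r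
  ... | refl = firstEntry-∈W xs

  residue⇒InW : ∀ {n} x (xs : Vec (Fin K) n) →
                coordSum (x ∷ xs) % K ≡ toℕ (residue (lastNonzero xs)) → InW 1F 2F (x ∷ xs)
  residue⇒InW {n} x xs sum≡r with lastNonzero xs in exs
  ... | just 0F            = ⊥-elim (lastNonzero≢just0 xs exs)
  ... | just 1F            = inj₁ (sum≡r , refl)
  ... | just (suc (suc _)) = inj₂ (_ , s≤s (s≤s z≤n) , sum≡r , refl)
  ... | nothing with lastNonzero≡nothing⇒zeros xs exs
  ...   | refl with ∷zeros-sum⇒≡ {n = n} x 1F sum≡r
  ...     | refl = inj₁ (sum≡r , refl)

  InW⇒∈W : ∀ {n} (v : Vec (Fin K) (suc n)) → InW 1F 2F v → v ∈ W n
  InW⇒∈W {n} (x ∷ xs) (inj₁ (sum≡1 , last≡1)) with lastNonzero-∷⁻ x xs last≡1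
  ... | inj₁ exs           = residue⇒∈W x xs (cong residue exs) sum≡1
  ... | inj₂ (refl , refl) = residue⇒∈W x xs (cong residue (lastNonzero-zeros n)) sum≡1
  InW⇒∈W _        (inj₂ (0F , () , _))
  InW⇒∈W _        (inj₂ (1F , s≤s () , _))
  InW⇒∈W {n} (x ∷ xs) (inj₂ (suc (suc _) , _ , sum≡2 , last≡i)) with lastNonzero-∷⁻ x xs last≡i
  ... | inj₁ exs = residue⇒∈W x xs (cong residue exs) sum≡2
  ... | inj₂ (refl , refl) with ∷zeros-sum⇒≡ {n = n} x 2F sum≡2
  ...   | refl = here refl

  ∈W⇒InW : ∀ {n} (v : Vec (Fin K) (suc n)) → v ∈ W n → InW 1F 2F v
  ∈W⇒InW {n} _ (here refl) rewrite coordSum-zeros {k = 2 + m} n | lastNonzero-zeros {k = 2 + m} n =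
    inj₂ (2F , s≤s (s≤s z≤n) , refl , refl)
  ∈W⇒InW _ (there v∈) with ∈-map⁻ _ v∈
  ... | xs , _ , refl = residue⇒InW (firstEntry xs) xs (Equivalence.to ≡⊖⇔+≡ refl)

  2F∷zeros≢firstEntry : ∀ {n} (xs : Vec (Fin K) n) → 2F ∷ zeros n ≢ firstEntry xs ∷ xs
  2F∷zeros≢firstEntry {n} xs e with ∷-injective e
  ... | 2F≡ , refl with trans (cong (λ s → (2 + s) % K) (sym (coordSum-zeros {k = 2 + m} n)))
                       (trans (Equivalence.to (≡⊖⇔+≡ {x = 2F} {s = coordSum (zeros n)}) 2F≡)
                              (cong (toℕ ∘ residue) (lastNonzero-zeros n)))
  ...   | ()

  W⁺ : ∀ n → Unique (W n)
  W⁺ n = All.map⁺ (All.universal 2F∷zeros≢firstEntry _) AllPairs.∷ Unique.map⁺ ∷-injectiveʳ (vectors⁺ (Unique.allFin⁺ K) n)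

  length-W : ∀ n → length (W n) ≡ K ^ n + 1
  length-W n = begin
    suc (length (map _ (vectors (allFin K) n))) ≡⟨ cong suc (length-map _ (vectors (allFin K) n)) ⟩
    suc (length (vectors (allFin K) n))         ≡⟨ cong suc (length-vectors (allFin K) n) ⟩
    suc (length (allFin K) ^ n)                 ≡⟨ cong (λ l → suc (l ^ n)) (length-tabulate (λ i → i)) ⟩
    suc (K ^ n)                                 ≡⟨ +-comm 1 (K ^ n) ⟩
    K ^ n + 1                                   ∎

lemma10 : (n k : ℕ) .{{_ : NonZero k}} → 1 ≤ n → (3≤k : 3 ≤ k) →
    Σ (List (Vertex n k)) λ W →
      Unique W
      × (∀ v → (v ∈ W) ⇔ InW (oneF 3≤k) (twoF 3≤k) v)
      × (length W ≡ k ^ (n ∸ 1) + 1)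
-- Splitting 3≤k makes oneF 3≤k and twoF 3≤k compute to 1F and 2F.
lemma10 (suc n) (suc (suc (suc m))) _ (s≤s (s≤s (s≤s _))) =
  W n , W⁺ n , (λ v → mk⇔ (∈W⇒InW v) (InW⇒∈W v)) , length-W n
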